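{- Let $U$ be a set and $S,P,M\subseteq U$, with complements $S',P',M'$ in $U$. Let $G=\{1,s,p,m,sp,sm,pm,spm\}$ be the group of term relabelings generated by $s:S\leftrightarrow S'$, $p:P\leftrightarrow P'$, $m:M\leftrightarrow M'$ (each fixing the other four terms), acting on statements by $g(E(X,Y))=E(g(X),g(Y))$, $g(I(X,Y))=I(g(X),g(Y))$, and on pairs of premises componentwise. Partition the 64 PCPs into the eight classes (1) $E(M^*,P^*)E(M^{*\prime},S^*)$, (2) $E(M^*,P^*)E(M^*,S^*)$, (3a) $E(M^*,P^*)I(M^*,S^*)$, (3b) $I(M^*,P^*)E(M^*,S^*)$, (4a) $I(M^*,P^*)I(M^*,S^*)$, (4b) $I(M^*,P^*)I(M^{*\prime},S^*)$, (5a) $E(M^*,P^*)I(M^{*\prime},S^*)$, (5b) $I(M^*,P^*)E(M^{*\prime},S^*)$, each class consisting of the 8 PCPs obtained by letting $M^*\in\{M,M'\}$, $P^*\in\{P,P'\}$, $S^*\in\{S,S'\}$ vary. Then each of these eight classes is invariant under $G$, and $G$ acts transitively on each class; in particular any PCP (together with its entailed consequences, relabeled accordingly) of one of the types (1), (2), (3a), (3b) is obtained by a relabeling from $G$ from, respectively, Barbara $E(M,P')E(M',S)$ (i.e. $A(M,P)A(S,M)$), Darapti $E(M,P')E(M,S')$ (i.e. $A(M,P)A(M,S)$), Darii $E(M,P')I(M,S)$ (i.e. $A(M,P)I(M,S)$), or Disamis $I(M,P)E(M,S')$ (i.e. $I(M,P)A(M,S)$).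
   Context: $E(X,Y)$: $X\cap Y=\emptyset$; $I(X,Y)$: $X\cap Y\neq\emptyset$; $A(X,Y)=E(X,Y')$; $O(X,Y)=I(X,Y')$. A PCP is an ordered pair (P-premise, S-premise), where a P-premise is $E(M^*,P^*)$ or $I(M^*,P^*)$ and an S-premise is $E(M^\circ,S^*)$ or $I(M^\circ,S^*)$ with $M^*,M^\circ\in\{M,M'\}$, $P^*\in\{P,P'\}$, $S^*\in\{S,S'\}$; $M^{*\prime}$ denotes the complement of $M^*$. -}

module Defs where

open import Data.Bool using (Bool; true; false; not; _xor_)
open import Data.Product using (_×_; _,_; Σ; ∃; ∃-syntax)
open import Relation.Binary.PropositionalEquality using (_≡_)
open import Relation.Nullary using (¬_)

data Letter : Set where
  S P M : Letter

-- A term is a letter together with a complement flag: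
-- (X , false) is X, (X , true) is X'.
Term : Set
Term = Letter × Bool

_′ : Term → Term
(x , b) ′ = (x , not b)

data Stmt : Set where
  E I : Term → Term → Stmt

-- A pair of premises (P-premise , S-premise).
Pair : Set
Pair = Stmt × Stmt

-- The group G = {1,s,p,m,sp,sm,pm,spm}: an element records which of the
-- swaps s : S↔S', p : P↔P', m : M↔M' it performs.
record G : Set where
  constructor rel
  field
    fs fp fm : Bool

flipOf : G → Letter → Bool
flipOf (rel fs fp fm) S = fs
flipOf (rel fs fp fm) P = fp
flipOf (rel fs fp fm) M = fm

actT : G → Term → Term
actT g (x , b) = (x , flipOf g x xor b)

actS : G → Stmt → Stmt
actS g (E X Y) = E (actT g X) (actT g Y)
actS g (I X Y) = I (actT g X) (actT g Y)

actP : G → Pair → Pair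
actP g (a , b) = (actS g a , actS g b)

Mt Pt St : Bool → Term
Mt b = (M , b)
Pt b = (P , b)
St b = (S , b)

data Class : Set where
  c1 c2 c3a c3b c4a c4b c5a c5b : Class

member : Class → Bool → Bool → Bool → Pair
member c1  m p s = (E (Mt m) (Pt p) , E (Mt m ′) (St s))
member c2  m p s = (E (Mt m) (Pt p) , E (Mt m) (St s))
member c3a m p s = (E (Mt m) (Pt p) , I (Mt m) (St s))
member c3b m p s = (I (Mt m) (Pt p) , E (Mt m) (St s))
member c4a m p s = (I (Mt m) (Pt p) , I (Mt m) (St s))
member c4b m p s = (I (Mt m) (Pt p) , I (Mt m ′) (St s))
member c5a m p s = (E (Mt m) (Pt p) , I (Mt m ′) (St s))
member c5b m p s = (I (Mt m) (Pt p) , E (Mt m ′) (St s))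

InClass : Class → Pair → Set
InClass k x = ∃[ m ] ∃[ p ] ∃[ s ] (member k m p s ≡ x)

-- Semantics: a universe U with subsets S, P, M given by characteristic functions.
⟦_⟧T : Term → {U : Set} → (U → Bool) → (U → Bool) → (U → Bool) → U → Bool
⟦ (S , b) ⟧T s p m u = b xor s u
⟦ (P , b) ⟧T s p m u = b xor p u
⟦ (M , b) ⟧T s p m u = b xor m u

Holds : {U : Set} → (U → Bool) → (U → Bool) → (U → Bool) → Stmt → Set
Holds {U} s p m (E X Y) = ¬ (∃[ u ] ((⟦ X ⟧T s p m u ≡ true) × (⟦ Y ⟧T s p m u ≡ true)))
Holds {U} s p m (I X Y) = ∃[ u ] ((⟦ X ⟧T s p m u ≡ true) × (⟦ Y ⟧T s p m u ≡ true))

Entails : Pair → Stmt → Set₁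
Entails (a , b) c = (U : Set) (s p m : U → Bool) → Holds s p m a → Holds s p m b → Holds s p m c

Barbara Darapti Darii Disamis : Pair
Barbara = (E (M , false) (P , true) , E (M , true) (S , false))
Darapti = (E (M , false) (P , true) , E (M , false) (S , true))
Darii   = (E (M , false) (P , true) , I (M , false) (S , false))
Disamis = (I (M , false) (P , false) , E (M , false) (S , true))

module Submission where

-- A relabeling g ∈ G flips the complement flags of S, P, M, i.e.
-- it acts on flag triples (m , p , s) by xor with its own flags.  Hence
--   * the class-k PCP with flags (m , p , s) is sent by g to the class-k PCP
--     with flags shifted by g (equivariance of `member`), so each class is
--     G-invariant, and the relabeling with flags (m ⊕ m' , p ⊕ p' , s ⊕ s')
--     carries the member with flags (m , p , s) to the one with (m' , p' , s'),
--     so G is transitive on each class;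
--   * semantically, evaluating a relabeled term in a model (S , P , M) is the
--     same as evaluating the original term in the model whose subsets are
--     complemented according to g.  So a statement holds after relabeling iff
--     it holds in the complemented model, and entailments are carried along by
--     any relabeling.
-- The theorem then follows: Barbara, Darapti, Darii and Disamis lie in classes
-- (1), (2), (3a), (3b), and transitivity plus transfer of entailment give the
-- required relabeling for every other member of these classes.

open import Defs
open import Data.Bool using (Bool; true; false; _xor_)
open import Data.Bool.Properties using (xor-assoc; xor-comm; xor-same; xor-identityʳ)
open import Data.Product using (_×_; _,_; ∃; ∃-syntax)
open import Relation.Binary.PropositionalEquality
  using (_≡_; refl; sym; trans; cong; subst)
open Relation.Binary.PropositionalEquality.≡-Reasoning

xor-shift-back : ∀ a b → (a xor b) xor a ≡ b
xor-shift-back a b = begin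
  (a xor b) xor a  ≡⟨ cong (_xor a) (xor-comm a b) ⟩
  (b xor a) xor a  ≡⟨ xor-assoc b a a ⟩
  b xor (a xor a)  ≡⟨ cong (b xor_) (xor-same a) ⟩
  b xor false      ≡⟨ xor-identityʳ b ⟩
  b                ∎

xor-swap-inner : ∀ f b x → (f xor b) xor x ≡ b xor (f xor x)
xor-swap-inner f b x = begin
  (f xor b) xor x  ≡⟨ cong (_xor x) (xor-comm f b) ⟩
  (b xor f) xor x  ≡⟨ xor-assoc b f x ⟩
  b xor (f xor x)  ∎

relMPS : Bool → Bool → Bool → G
relMPS m p s = rel s p m

-- Classes mentioning
-- M^*' need a split on g's M-flag so that the flip commutes with `not`.
act-member : ∀ k g m p s →
  actP g (member k m p s)
    ≡ member k (flipOf g M xor m) (flipOf g P xor p) (flipOf g S xor s)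
act-member c1  (rel fs fp false) m p s = refl
act-member c1  (rel fs fp true)  m p s = refl
act-member c2  g                 m p s = refl
act-member c3a g                 m p s = refl
act-member c3b g                 m p s = refl
act-member c4a g                 m p s = refl
act-member c4b (rel fs fp false) m p s = refl
act-member c4b (rel fs fp true)  m p s = refl
act-member c5a (rel fs fp false) m p s = refl
act-member c5a (rel fs fp true)  m p s = refl
act-member c5b (rel fs fp false) m p s = refl
act-member c5b (rel fs fp true)  m p s = refl

class-invariant : (k : Class) (g : G) (x : Pair) → InClass k x → InClass k (actP g x)
class-invariant k g x (m , p , s , refl) = _ , _ , _ , sym (act-member k g m p s)

connect-members : ∀ k m p s m' p' s' →
  actP (relMPS (m xor m') (p xor p') (s xor s')) (member k m p s) ≡ member k m' p' s'
connect-members k m p s m' p' s' = begin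
  actP (relMPS (m xor m') (p xor p') (s xor s')) (member k m p s)
    ≡⟨ act-member k (relMPS (m xor m') (p xor p') (s xor s')) m p s ⟩
  member k ((m xor m') xor m) ((p xor p') xor p) ((s xor s') xor s)
    ≡⟨ cong (λ a → member k a ((p xor p') xor p) ((s xor s') xor s)) (xor-shift-back m m') ⟩
  member k m' ((p xor p') xor p) ((s xor s') xor s)
    ≡⟨ cong (λ b → member k m' b ((s xor s') xor s)) (xor-shift-back p p') ⟩
  member k m' p' ((s xor s') xor s)
    ≡⟨ cong (member k m' p') (xor-shift-back s s') ⟩
  member k m' p' s' ∎

class-transitive : (k : Class) (x y : Pair) → InClass k x → InClass k y → ∃[ g ] (actP g x ≡ y)
class-transitive k x y (m , p , s , refl) (m' , p' , s' , refl) =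
  _ , connect-members k m p s m' p' s'

complementIf : {U : Set} → Bool → (U → Bool) → U → Bool
complementIf f χ u = f xor χ u

module Relabeled {U : Set} (g : G) (s p m : U → Bool) where

  s′ p′ m′ : U → Bool
  s′ = complementIf (flipOf g S) s
  p′ = complementIf (flipOf g P) p
  m′ = complementIf (flipOf g M) m

  eval-act : ∀ X u → ⟦ actT g X ⟧T s p m u ≡ ⟦ X ⟧T s′ p′ m′ u
  eval-act (S , b) u = xor-swap-inner (flipOf g S) b (s u)
  eval-act (P , b) u = xor-swap-inner (flipOf g P) b (p u)
  eval-act (M , b) u = xor-swap-inner (flipOf g M) b (m u)

  overlap→ : ∀ X Y →
    ∃[ u ] ((⟦ actT g X ⟧T s p m u ≡ true) × (⟦ actT g Y ⟧T s p m u ≡ true)) →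
    ∃[ u ] ((⟦ X ⟧T s′ p′ m′ u ≡ true) × (⟦ Y ⟧T s′ p′ m′ u ≡ true))
  overlap→ X Y (u , x∈ , y∈) =
    u , trans (sym (eval-act X u)) x∈ , trans (sym (eval-act Y u)) y∈

  overlap← : ∀ X Y →
    ∃[ u ] ((⟦ X ⟧T s′ p′ m′ u ≡ true) × (⟦ Y ⟧T s′ p′ m′ u ≡ true)) →
    ∃[ u ] ((⟦ actT g X ⟧T s p m u ≡ true) × (⟦ actT g Y ⟧T s p m u ≡ true))
  overlap← X Y (u , x∈ , y∈) = u , trans (eval-act X u) x∈ , trans (eval-act Y u) y∈

  holds-act→ : ∀ c → Holds s p m (actS g c) → Holds s′ p′ m′ c
  holds-act→ (E X Y) disjoint meet = disjoint (overlap← X Y meet)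
  holds-act→ (I X Y) meet          = overlap→ X Y meet

  holds-act← : ∀ c → Holds s′ p′ m′ c → Holds s p m (actS g c)
  holds-act← (E X Y) disjoint meet = disjoint (overlap→ X Y meet)
  holds-act← (I X Y) meet          = overlap← X Y meet

open Relabeled using (holds-act→; holds-act←)

entails-act : ∀ g x c → Entails x c → Entails (actP g x) (actS g c)
entails-act g (a , b) c entails U s p m ha hb =
  holds-act← g s p m c (entails U _ _ _ (holds-act→ g s p m a ha) (holds-act→ g s p m b hb))

from-representative : ∀ k B → InClass k B → (x : Pair) → InClass k x →
  ∃[ g ] ((actP g B ≡ x) × ((c : Stmt) → Entails B c → Entails x (actS g c)))
from-representative k B B∈k x x∈k with class-transitive k B x B∈k x∈k
... | g , gB≡x = g , gB≡x , λ c e → subst (λ z → Entails z (actS g c)) gB≡x (entails-act g B c e)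

mainTheorem5 :
    ((k : Class) (g : G) (x : Pair) → InClass k x → InClass k (actP g x))
    × ((k : Class) (x y : Pair) → InClass k x → InClass k y → ∃[ g ] (actP g x ≡ y))
    × ((x : Pair) → InClass c1 x → ∃[ g ] ((actP g Barbara ≡ x) × ((c : _) → Entails Barbara c → Entails x (actS g c))))
    × ((x : Pair) → InClass c2 x → ∃[ g ] ((actP g Darapti ≡ x) × ((c : _) → Entails Darapti c → Entails x (actS g c))))
    × ((x : Pair) → InClass c3a x → ∃[ g ] ((actP g Darii ≡ x) × ((c : _) → Entails Darii c → Entails x (actS g c))))
    × ((x : Pair) → InClass c3b x → ∃[ g ] ((actP g Disamis ≡ x) × ((c : _) → Entails Disamis c → Entails x (actS g c))))
mainTheorem5 =
  class-invariant , class-transitive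
  , from-representative c1  Barbara (false , true  , false , refl)
  , from-representative c2  Darapti (false , true  , true  , refl)
  , from-representative c3a Darii   (false , true  , false , refl)
  , from-representative c3b Disamis (false , false , true  , refl)
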